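{- Let $A\in\mathcal C_4(G_n)$ with $d(A)>1$. If $B\in\mathcal C_4(G_n)$ and $B\sim A$, then $d(B)=d(A)$.
   Context: Fix $n\ge5$. $G_n$ is a simple plane triangulation having two non-adjacent vertices $a,b$ of degree $n$ (the poles) and $2n$ vertices of degree $5$. $N_a,N_b$ are the cycles induced by the neighbours of $a$ and $b$. An edge is of type 1 if one end lies on $N_a$ and the other on $N_b$. $\mathcal C_4(G_n)$ is the set of 4-colourings $V(G_n)\to\{1,2,3,4\}$; $A(i,j)$ is the subgraph induced by the vertices coloured $i$ or $j$, its components are Kempe chains, a Kempe change swaps $i,j$ on one Kempe chain, and $A\sim B$ means one is obtained from the other by finitely many Kempe changes. Convention: a 4-colouring with both poles of the same colour exists only when $3\mid n$, is unique up to permutation of colours, is denoted $Q$, and $d(Q)=0$. Every other 4-colouring is normalized, by permuting colours, so that the poles receive colours 1 and 2, and then $d(A)$ is the number of type-1 edges in $A(1,2)$. -}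

module Defs where

open import Data.Nat using (ℕ; zero; suc; _+_; _≤_; _<_)
open import Data.Fin using (Fin; zero; suc) renaming (_≟_ to _≟ᶠ_)
open import Data.Maybe using (Maybe; just; nothing; fromMaybe)
import Data.Maybe as Maybe
open import Data.List using (List; map)
open import Data.Nat.ListAction using (sum)
open import Data.List.Base using (allFin)
open import Data.Product using (Σ; ∃; _×_; _,_; proj₁)
open import Data.Sum using (_⊎_)
open import Relation.Nullary.Decidable using () renaming (_⊎-dec_ to _⊎?_)
open import Relation.Nullary using (¬_; Dec; yes; no)
open import Relation.Binary.PropositionalEquality using (_≡_; _≢_)
open import Relation.Binary.Construct.Closure.ReflexiveTransitive using (Star)

-- The graph G_n : poles a, b; N_a = u 0 … u (n-1); N_b = w 0 … w (n-1);
-- the two cycles are joined as an antiprism (u i ~ w i, u i ~ w (i+1)).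

succ? : ∀ {n} → Fin n → Maybe (Fin n)
succ? {suc zero} zero = nothing
succ? {suc (suc m)} zero = just (suc zero)
succ? {suc (suc m)} (suc i) = Maybe.map suc (succ? i)

next : ∀ {n} → Fin n → Fin n
next {suc m} i = fromMaybe zero (succ? i)

data V (n : ℕ) : Set where
  pa pb : V n
  u w   : Fin n → V n

data Edge {n : ℕ} : V n → V n → Set where
  aU  : (i : Fin n) → Edge pa (u i)
  bW  : (i : Fin n) → Edge pb (w i)
  uu  : (i : Fin n) → Edge (u i) (u (next i))
  ww  : (i : Fin n) → Edge (w i) (w (next i))
  uw  : (i : Fin n) → Edge (u i) (w i)
  uw' : (i : Fin n) → Edge (u i) (w (next i))

Adj : ∀ {n} → V n → V n → Set
Adj x y = Edge x y ⊎ Edge y x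

Colour : Set
Colour = Fin 4

C4 : ℕ → Set
C4 n = Σ (V n → Colour) (λ c → ∀ x y → Adj x y → c x ≢ c y)

InIJ : ∀ {n} → (V n → Colour) → Colour → Colour → V n → Set
InIJ c i j x = c x ≡ i ⊎ c x ≡ j

-- y lies in the Kempe chain of A(i,j) containing x
data Reach {n} (c : V n → Colour) (i j : Colour) (x : V n) : V n → Set where
  base : InIJ c i j x → Reach c i j x x
  ext  : ∀ {y z} → Reach c i j x y → Adj y z → InIJ c i j z → Reach c i j x z

swap : Colour → Colour → Colour → Colour
swap i j k with k ≟ᶠ i
... | yes _ = j
... | no _ with k ≟ᶠ j
...   | yes _ = i
...   | no _ = k

KempeChange : ∀ {n} → C4 n → C4 n → Set
KempeChange {n} (c , _) (c' , _) =
  Σ Colour λ i → Σ Colour λ j → Σ (V n) λ v →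
    InIJ c i j v ×
    (∀ x → (Reach c i j v x → c' x ≡ swap i j (c x)) ×
           (¬ Reach c i j v x → c' x ≡ c x))

_∼_ : ∀ {n} → C4 n → C4 n → Set
_∼_ = Star KempeChange

-- d(A): 0 if the poles have the same colour (the colouring Q);
-- otherwise, after normalising the pole colours to 1 and 2, the number of
-- type-1 edges (u i w i, u i w (i+1)) of A(1,2), i.e. type-1 edges whose
-- both ends have a pole colour.

ind : {P : Set} → Dec P → ℕ
ind (yes _) = 1
ind (no _)  = 0

inPoles : ∀ {n} → (c : V n → Colour) → (x : V n) → Dec (InIJ c (c pa) (c pb) x)
inPoles c x = (c x ≟ᶠ c pa) ⊎? (c x ≟ᶠ c pb)

edgeIn : ∀ {n} → (c : V n → Colour) → V n → V n → ℕ
edgeIn c x y with inPoles c x | inPoles c y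
... | yes _ | yes _ = 1
... | _     | _     = 0

d : ∀ {n} → C4 n → ℕ
d {n} (c , _) with c pa ≟ᶠ c pb
... | yes _ = 0
... | no _  = sum (map (λ i → edgeIn c (u i) (w i) + edgeIn c (u i) (w (next i))) (allFin n))

-- Let P ≠ Q be the colours of the poles a, b, K the number of neighbours of a
-- coloured Q and M the number of neighbours of b coloured P.  Counting the
-- colours P, Q on the triangles u i, w i, w (i+1) and w (i+1), u i, u (i+1)
-- gives n + d = 2M + K = 2K + M, hence n + d = 3K = 3M.  If d > 0, a type-1 edge
-- coloured Q, P puts a and b into one Kempe chain of A(P,Q), so no Kempe change
-- separates them: it keeps P ≠ Q, and it preserves K when the colour of a is
-- among the swapped pair (the neighbours of a move together with a, hence with b)
-- and M otherwise (no vertex gains or loses the colour of a).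

module Submission where

open import Defs
open import Data.Nat using (ℕ; zero; suc; _+_; _*_; _≤_; _<_; z<s; _≟_)
open import Data.Nat.Tactic.RingSolver using (solve-∀)
open import Data.Nat.Properties using (*-zeroʳ; n≮0; +-comm; *-comm; +-assoc; +-cancelˡ-≡; +-cancelʳ-≡; +-0-commutativeMonoid; <-trans)
import Data.Nat.ListAction as ListAction
open import Algebra.Properties.CommutativeMonoid.Sum +-0-commutativeMonoid using (sum; sum-cong-≗; ∑-distrib-+)
open import Data.Fin using (Fin; zero; suc) renaming (_≟_ to _≟ᶠ_)
open import Data.Fin.Properties using (all?)
open import Data.Fin.Permutation.Components using (transpose; transpose-inverse)
open import Data.Maybe using (Maybe; just; nothing; fromMaybe)
import Data.Maybe as Maybe
open import Data.List using (map; tabulate; allFin)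
open import Data.List.Properties using (map-tabulate)
open import Data.Product using (Σ-syntax; ∃; _×_; _,_; proj₁; proj₂)
open import Data.Sum using (_⊎_; inj₁; inj₂)
open import Data.Empty using (⊥-elim)
open import Data.Unit using (tt)
open import Function using (_∘_; id; _⇔_; mk⇔; Equivalence)
open import Function.Construct.Symmetry using (⇔-sym)
open import Function.Construct.Composition using (_⇔-∘_)
open import Relation.Nullary using (¬_; Dec; yes; no)
open import Relation.Nullary.Decidable using (toWitness; decidable-stable; _⊎-dec_; _→-dec_; ¬?)
open import Relation.Binary.PropositionalEquality
open import Relation.Binary.Construct.Closure.ReflexiveTransitive using (ε; _◅_)

open Equivalence using (to; from)

sum-ones : ∀ n → sum {n} (λ _ → 1) ≡ n
sum-ones zero    = refl
sum-ones (suc n) = cong suc (sum-ones n)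

sum-tabulate : ∀ {n} (f : Fin n → ℕ) → ListAction.sum (tabulate f) ≡ sum f
sum-tabulate {zero}  f = refl
sum-tabulate {suc n} f = cong (f zero +_) (sum-tabulate (f ∘ suc))

sum-allFin : ∀ {n} (f : Fin n → ℕ) → ListAction.sum (map f (allFin n)) ≡ sum f
sum-allFin f = trans (cong ListAction.sum (map-tabulate id f)) (sum-tabulate f)

-- Rotation invariance: next = fromMaybe zero ∘ succ?, and succ? sends the last index to nothing.
sum-succ? : ∀ m (F : Maybe (Fin (suc m)) → ℕ) →
            sum (F ∘ succ?) + F (just zero) ≡ sum (F ∘ just) + F nothing
sum-succ? zero F = swap-ends (F nothing) 0 (F (just zero))
  where
  swap-ends : ∀ a s b → a + s + b ≡ b + s + a
  swap-ends = solve-∀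
sum-succ? (suc m) F = begin
  F (just (suc zero)) + sum (G ∘ succ?) + F (just zero) ≡⟨ cong (_+ F (just zero)) (+-comm (F (just (suc zero))) _) ⟩
  sum (G ∘ succ?) + G (just zero) + F (just zero)       ≡⟨ cong (_+ F (just zero)) (sum-succ? m G) ⟩
  sum (G ∘ just) + F nothing + F (just zero)            ≡⟨ rotate (sum (G ∘ just)) (F nothing) (F (just zero)) ⟩
  sum (F ∘ just) + F nothing                            ∎
  where
  open ≡-Reasoning
  G : Maybe (Fin (suc m)) → ℕ
  G = F ∘ Maybe.map suc
  rotate : ∀ s a b → s + a + b ≡ b + s + a
  rotate = solve-∀

sum-next : ∀ {n} (f : Fin n → ℕ) → sum (f ∘ next) ≡ sum f
sum-next {zero}  f = refl
sum-next {suc m} f = +-cancelʳ-≡ (f zero) _ _ (sum-succ? m (f ∘ fromMaybe zero))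

sum-triangles : ∀ {n} (f g e : Fin n → ℕ) → (∀ i → f i + f (next i) + g i ≡ 1 + e i) →
                sum f + sum f + sum g ≡ n + sum e
sum-triangles {n} f g e triangle = begin
  sum f + sum f + sum g                ≡⟨ cong (λ t → sum f + t + sum g) (sum-next f) ⟨
  sum f + sum (f ∘ next) + sum g       ≡⟨ cong (_+ sum g) (∑-distrib-+ f (f ∘ next)) ⟨
  sum (λ i → f i + f (next i)) + sum g ≡⟨ ∑-distrib-+ (λ i → f i + f (next i)) g ⟨
  sum (λ i → f i + f (next i) + g i)   ≡⟨ sum-cong-≗ triangle ⟩
  sum (λ i → 1 + e i)                  ≡⟨ ∑-distrib-+ {n} (λ _ → 1) e ⟩
  sum {n} (λ _ → 1) + sum e            ≡⟨ cong (_+ sum e) (sum-ones n) ⟩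
  n + sum e                            ∎
  where open ≡-Reasoning

m+n>0⇒m>0⊎n>0 : ∀ m n → 0 < m + n → 0 < m ⊎ 0 < n
m+n>0⇒m>0⊎n>0 zero    n h = inj₂ h
m+n>0⇒m>0⊎n>0 (suc m) n h = inj₁ z<s

sum>0⇒∃>0 : ∀ {n} (f : Fin n → ℕ) → 0 < sum f → ∃ λ i → 0 < f i
sum>0⇒∃>0 {suc n} f h with m+n>0⇒m>0⊎n>0 (f zero) (sum (f ∘ suc)) h
... | inj₁ f0>0 = zero , f0>0
... | inj₂ rest>0 with sum>0⇒∃>0 (f ∘ suc) rest>0
...   | i , fi>0 = suc i , fi>0

m+m+k≡k+k+m⇒m≡k : ∀ m k → m + m + k ≡ k + k + m → m ≡ k
m+m+k≡k+k+m⇒m≡k m k eq = +-cancelʳ-≡ (m + k) m k (begin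
  m + (m + k) ≡⟨ +-assoc m m k ⟨
  m + m + k   ≡⟨ eq ⟩
  k + k + m   ≡⟨ +-assoc k k m ⟩
  k + (k + m) ≡⟨ cong (k +_) (+-comm k m) ⟩
  k + (m + k) ∎)
  where open ≡-Reasoning

δ : Colour → Colour → ℕ
δ x y = ind (x ≟ᶠ y)

δ-≡ : ∀ {x y} → x ≡ y → δ x y ≡ 1
δ-≡ {x} {y} x≡y with x ≟ᶠ y
... | yes _   = refl
... | no x≢y = ⊥-elim (x≢y x≡y)

δ-≢ : ∀ {x y} → x ≢ y → δ x y ≡ 0
δ-≢ {x} {y} x≢y with x ≟ᶠ y
... | yes x≡y = ⊥-elim (x≢y x≡y)
... | no _    = refl

δ-cong-⇔ : ∀ {x y x′ y′} → (x ≡ y ⇔ x′ ≡ y′) → δ x y ≡ δ x′ y′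
δ-cong-⇔ {x} {y} {x′} {y′} eq with x ≟ᶠ y | x′ ≟ᶠ y′
... | yes _   | yes _    = refl
... | no _    | no _     = refl
... | yes x≡y | no x′≢y′ = ⊥-elim (x′≢y′ (to eq x≡y))
... | no x≢y  | yes x′≡y′ = ⊥-elim (x≢y (from eq x′≡y′))

TriangleCount : Colour → Colour → Colour → Colour → Colour → Set
TriangleCount P Q X Y Z =
  P ≢ Q → X ≢ P → Y ≢ Q → Z ≢ Q → X ≢ Y → X ≢ Z → Y ≢ Z →
  δ Y P + δ Z P + δ X Q ≡ 1 + (δ X Q * δ Y P + δ X Q * δ Z P)

-- Checked on all 4⁵ colour tuples.  If X = Q the two sides agree term by term;
-- otherwise X, Y, Z are distinct colours other than Q and X ≠ P, so exactly one
-- of Y, Z is P.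
triangle-count : ∀ P Q X Y Z → TriangleCount P Q X Y Z
triangle-count = toWitness {a? = all? λ P → all? λ Q → all? λ X → all? λ Y → all? λ Z → triangleCount? P Q X Y Z} tt
  where
  _≢?_ : (x y : Colour) → Dec (x ≢ y)
  x ≢? y = ¬? (x ≟ᶠ y)
  triangleCount? : ∀ P Q X Y Z → Dec (TriangleCount P Q X Y Z)
  triangleCount? P Q X Y Z =
    P ≢? Q →-dec X ≢? P →-dec Y ≢? Q →-dec Z ≢? Q →-dec X ≢? Y →-dec X ≢? Z →-dec Y ≢? Z →-dec
    (δ Y P + δ Z P + δ X Q ≟ 1 + (δ X Q * δ Y P + δ X Q * δ Z P))

∈ij-resp : ∀ {k k′ i j : Colour} → k ≡ k′ → k ≡ i ⊎ k ≡ j → k′ ≡ i ⊎ k′ ≡ j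
∈ij-resp refl k∈ = k∈

∈ij-≢ˡ : ∀ {k i j : Colour} → k ≡ i ⊎ k ≡ j → k ≢ i → k ≡ j
∈ij-≢ˡ (inj₁ k≡i) k≢i = ⊥-elim (k≢i k≡i)
∈ij-≢ˡ (inj₂ k≡j) _   = k≡j

∈ij-≢ʳ : ∀ {k i j : Colour} → k ≡ i ⊎ k ≡ j → k ≢ j → k ≡ i
∈ij-≢ʳ (inj₁ k≡i) _   = k≡i
∈ij-≢ʳ (inj₂ k≡j) k≢j = ⊥-elim (k≢j k≡j)

swap≗transpose : ∀ i j k → swap i j k ≡ transpose i j k
swap≗transpose i j k with k ≟ᶠ i
... | yes _ = refl
... | no _ with k ≟ᶠ j
...   | yes _ = refl
...   | no _  = refl

swap-injective : ∀ i j {x y} → swap i j x ≡ swap i j y → x ≡ y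
swap-injective i j {x} {y} eq = begin
  x                               ≡⟨ transpose-inverse j i ⟨
  transpose j i (transpose i j x) ≡⟨ cong (transpose j i) (trans (sym (swap≗transpose i j x)) (trans eq (swap≗transpose i j y))) ⟩
  transpose j i (transpose i j y) ≡⟨ transpose-inverse j i ⟩
  y                               ∎
  where open ≡-Reasoning

swap-self : ∀ i k → swap i i k ≡ k
swap-self i k with k ≟ᶠ i
... | yes k≡i = sym k≡i
... | no _ with k ≟ᶠ i
...   | yes k≡i = sym k≡i
...   | no _    = refl

swap-ˡ : ∀ i j → swap i j i ≡ j
swap-ˡ i j with i ≟ᶠ i
... | yes _   = refl
... | no i≢i = ⊥-elim (i≢i refl)

swap-ʳ : ∀ i j → swap i j j ≡ i
swap-ʳ i j with j ≟ᶠ i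
... | yes j≡i = j≡i
... | no _ with j ≟ᶠ j
...   | yes _   = refl
...   | no j≢j = ⊥-elim (j≢j refl)

swap-∈ij : ∀ {i j k} → k ≡ i ⊎ k ≡ j → swap i j k ≡ i ⊎ swap i j k ≡ j
swap-∈ij {i} {j} (inj₁ refl) = inj₂ (swap-ˡ i j)
swap-∈ij {i} {j} (inj₂ refl) = inj₁ (swap-ʳ i j)

swap-moves : ∀ {i j k} → i ≢ j → k ≡ i ⊎ k ≡ j → swap i j k ≢ k
swap-moves {i} {j} i≢j (inj₁ refl) j≡i = i≢j (sym (trans (sym (swap-ˡ i j)) j≡i))
swap-moves {i} {j} i≢j (inj₂ refl) i≡j = i≢j (trans (sym (swap-ʳ i j)) i≡j)

module _ {n : ℕ} where

  uLikeB wLikeA typeOne : (V n → Colour) → Fin n → ℕ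
  uLikeB  c k = δ (c (u k)) (c pb)
  wLikeA  c k = δ (c (w k)) (c pa)
  typeOne c k = edgeIn c (u k) (w k) + edgeIn c (u k) (w (next k))

  Proper : (V n → Colour) → Set
  Proper c = ∀ x y → Adj x y → c x ≢ c y

  edgeIn-δ : ∀ (c : V n → Colour) x y → c x ≢ c pa → c y ≢ c pb →
             edgeIn c x y ≡ δ (c x) (c pb) * δ (c y) (c pa)
  edgeIn-δ c x y x≢P y≢Q with inPoles c x | inPoles c y
  ... | yes (inj₁ x≡P) | _              = ⊥-elim (x≢P x≡P)
  ... | _              | yes (inj₂ y≡Q) = ⊥-elim (y≢Q y≡Q)
  ... | yes (inj₂ x≡Q) | yes (inj₁ y≡P) = sym (cong₂ _*_ (δ-≡ x≡Q) (δ-≡ y≡P))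
  ... | no x∉          | _              = sym (cong (_* δ (c y) (c pa)) (δ-≢ (x∉ ∘ inj₂)))
  ... | yes (inj₂ _)   | no y∉          =
    sym (trans (cong (δ (c x) (c pb) *_) (δ-≢ (y∉ ∘ inj₁))) (*-zeroʳ (δ (c x) (c pb))))

  edgeIn>0 : ∀ (c : V n → Colour) x y → 0 < edgeIn c x y →
             InIJ c (c pa) (c pb) x × InIJ c (c pa) (c pb) y
  edgeIn>0 c x y h with inPoles c x | inPoles c y
  ... | yes x∈ | yes y∈ = x∈ , y∈
  ... | yes _  | no _   = ⊥-elim (n≮0 h)
  ... | no _   | _      = ⊥-elim (n≮0 h)

  module Counting (c : V n → Colour) (proper : Proper c) (P≢Q : c pa ≢ c pb) where

    private
      U W : Fin n → ℕ
      U = uLikeB c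
      W = wLikeA c

      edge-≢ : ∀ {x y} → Edge x y → c x ≢ c y
      edge-≢ e = proper _ _ (inj₁ e)

      edge-≢′ : ∀ {x y} → Edge x y → c y ≢ c x
      edge-≢′ e = edge-≢ e ∘ sym

    typeOne-δ : ∀ k → typeOne c k ≡ U k * W k + U k * W (next k)
    typeOne-δ k = cong₂ _+_ (edgeIn-δ c (u k) (w k) (edge-≢′ (aU k)) (edge-≢′ (bW k)))
                            (edgeIn-δ c (u k) (w (next k)) (edge-≢′ (aU k)) (edge-≢′ (bW (next k))))

    rotated-typeOne : sum (λ k → W (next k) * U k + W (next k) * U (next k)) ≡ sum (typeOne c)
    rotated-typeOne = begin
      sum (λ k → W (next k) * U k + W (next k) * U (next k))
        ≡⟨ ∑-distrib-+ (λ k → W (next k) * U k) (λ k → W (next k) * U (next k)) ⟩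
      sum (λ k → W (next k) * U k) + sum (λ k → W (next k) * U (next k))
        ≡⟨ cong (sum (λ k → W (next k) * U k) +_) (sum-next (λ k → W k * U k)) ⟩
      sum (λ k → W (next k) * U k) + sum (λ k → W k * U k)
        ≡⟨ +-comm (sum (λ k → W (next k) * U k)) _ ⟩
      sum (λ k → W k * U k) + sum (λ k → W (next k) * U k)
        ≡⟨ ∑-distrib-+ (λ k → W k * U k) (λ k → W (next k) * U k) ⟨
      sum (λ k → W k * U k + W (next k) * U k)
        ≡⟨ sum-cong-≗ (λ k → trans (cong₂ _+_ (*-comm (W k) (U k)) (*-comm (W (next k)) (U k)))
                                   (sym (typeOne-δ k))) ⟩
      sum (typeOne c) ∎
      where open ≡-Reasoning

    count-w : sum W + sum W + sum U ≡ n + sum (typeOne c)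
    count-w = trans (sum-triangles W U (λ k → U k * W k + U k * W (next k)) triangle)
                    (cong (n +_) (sum-cong-≗ (sym ∘ typeOne-δ)))
      where
      triangle : ∀ k → W k + W (next k) + U k ≡ 1 + (U k * W k + U k * W (next k))
      triangle k = triangle-count (c pa) (c pb) (c (u k)) (c (w k)) (c (w (next k))) P≢Q
        (edge-≢′ (aU k)) (edge-≢′ (bW k)) (edge-≢′ (bW (next k)))
        (edge-≢ (uw k)) (edge-≢ (uw' k)) (edge-≢ (ww k))

    count-u : sum U + sum U + sum W ≡ n + sum (typeOne c)
    count-u = begin
      sum U + sum U + sum W
        ≡⟨ cong (sum U + sum U +_) (sum-next W) ⟨
      sum U + sum U + sum (W ∘ next)
        ≡⟨ sum-triangles U (W ∘ next) (λ k → W (next k) * U k + W (next k) * U (next k)) triangle ⟩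
      n + sum (λ k → W (next k) * U k + W (next k) * U (next k))
        ≡⟨ cong (n +_) rotated-typeOne ⟩
      n + sum (typeOne c) ∎
      where
      open ≡-Reasoning
      triangle : ∀ k → U k + U (next k) + W (next k) ≡ 1 + (W (next k) * U k + W (next k) * U (next k))
      triangle k = triangle-count (c pb) (c pa) (c (w (next k))) (c (u k)) (c (u (next k))) (P≢Q ∘ sym)
        (edge-≢′ (bW (next k))) (edge-≢′ (aU k)) (edge-≢′ (aU (next k)))
        (edge-≢′ (uw' k)) (edge-≢′ (uw (next k))) (edge-≢ (uu k))

    sum-uLikeB≡sum-wLikeA : sum (uLikeB c) ≡ sum (wLikeA c)
    sum-uLikeB≡sum-wLikeA = m+m+k≡k+k+m⇒m≡k (sum U) (sum W) (trans count-u (sym count-w))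

    count-uLikeB : n + sum (typeOne c) ≡ sum U + sum U + sum U
    count-uLikeB = trans (sym count-u) (cong (sum U + sum U +_) (sym sum-uLikeB≡sum-wLikeA))

  d-same : ∀ (X : C4 n) → proj₁ X pa ≡ proj₁ X pb → d X ≡ 0
  d-same (c , _) P≡Q with c pa ≟ᶠ c pb
  ... | yes _   = refl
  ... | no P≢Q = ⊥-elim (P≢Q P≡Q)

  d-distinct : ∀ (X : C4 n) → proj₁ X pa ≢ proj₁ X pb → d X ≡ sum (typeOne (proj₁ X))
  d-distinct (c , _) P≢Q with c pa ≟ᶠ c pb
  ... | yes P≡Q = ⊥-elim (P≢Q P≡Q)
  ... | no _    = sum-allFin (typeOne c)

  d>0⇒distinct : ∀ (X : C4 n) → 0 < d X → proj₁ X pa ≢ proj₁ X pb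
  d>0⇒distinct X d>0 P≡Q = n≮0 (subst (0 <_) (d-same X P≡Q) d>0)

  d-via-uLikeB : ∀ (X : C4 n) (P≢Q : proj₁ X pa ≢ proj₁ X pb) →
                 let s = sum (uLikeB (proj₁ X)) in n + d X ≡ s + s + s
  d-via-uLikeB X@(c , proper) P≢Q = trans (cong (n +_) (d-distinct X P≢Q)) (Counting.count-uLikeB c proper P≢Q)

  d-determined-by-uLikeB : ∀ (X Y : C4 n) → proj₁ X pa ≢ proj₁ X pb → proj₁ Y pa ≢ proj₁ Y pb →
                           sum (uLikeB (proj₁ X)) ≡ sum (uLikeB (proj₁ Y)) → d X ≡ d Y
  d-determined-by-uLikeB X Y P≢Q P′≢Q′ eq = +-cancelˡ-≡ n (d X) (d Y) (begin
    n + d X      ≡⟨ d-via-uLikeB X P≢Q ⟩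
    sX + sX + sX ≡⟨ cong (λ s → s + s + s) eq ⟩
    sY + sY + sY ≡⟨ d-via-uLikeB Y P′≢Q′ ⟨
    n + d Y      ∎)
    where
    open ≡-Reasoning
    sX sY : ℕ
    sX = sum (uLikeB (proj₁ X))
    sY = sum (uLikeB (proj₁ Y))

  Linked : (V n → Colour) → V n → V n → Set
  Linked c s t = Σ[ x ∈ V n ] Σ[ y ∈ V n ] Adj s x × Adj x y × Adj y t × c x ≡ c t × c y ≡ c s

  linked⇒distinct : ∀ {c s t} → Proper c → Linked c s t → c s ≢ c t
  linked⇒distinct proper (x , _ , s~x , _ , _ , cx≡ct , _) cs≡ct = proper _ x s~x (trans cs≡ct (sym cx≡ct))

  type-one-edge⇒linked : ∀ {c k m} → Proper c → Edge (u k) (w m) → 0 < edgeIn c (u k) (w m) →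
                         Linked c pa pb
  type-one-edge⇒linked {c} {k} {m} proper e h with edgeIn>0 c (u k) (w m) h
  ... | uk∈ , wm∈ = u k , w m , inj₁ (aU k) , inj₁ e , inj₂ (bW m)
                  , ∈ij-≢ˡ uk∈ (λ eq → proper _ _ (inj₁ (aU k)) (sym eq))
                  , ∈ij-≢ʳ wm∈ (λ eq → proper _ _ (inj₁ (bW m)) (sym eq))

  d>0⇒linked : ∀ (X : C4 n) → 0 < d X → Linked (proj₁ X) pa pb
  d>0⇒linked X@(c , proper) d>0
    with sum>0⇒∃>0 (typeOne c) (subst (0 <_) (d-distinct X (d>0⇒distinct X d>0)) d>0)
  ... | k , typeOne>0 with m+n>0⇒m>0⊎n>0 (edgeIn c (u k) (w k)) _ typeOne>0
  ...   | inj₁ h = type-one-edge⇒linked proper (uw k) h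
  ...   | inj₂ h = type-one-edge⇒linked proper (uw' k) h

adj-sym : ∀ {n} {x y : V n} → Adj x y → Adj y x
adj-sym (inj₁ e) = inj₂ e
adj-sym (inj₂ e) = inj₁ e

Reach⇒InIJ : ∀ {n} {c : V n → Colour} {i j x y} → Reach c i j x y → InIJ c i j y
Reach⇒InIJ (base y∈)    = y∈
Reach⇒InIJ (ext _ _ y∈) = y∈

InIJ? : ∀ {n} (c : V n → Colour) i j x → Dec (InIJ c i j x)
InIJ? c i j x = (c x ≟ᶠ i) ⊎-dec (c x ≟ᶠ j)

module Kempe {n : ℕ} (c c′ : V n → Colour) (i j : Colour) (v : V n)
  (change : ∀ x → (Reach c i j v x → c′ x ≡ swap i j (c x)) × (¬ Reach c i j v x → c′ x ≡ c x)) where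

  Changed : V n → Set
  Changed x = c′ x ≢ c x

  changed? : ∀ x → Dec (Changed x)
  changed? x = ¬? (c′ x ≟ᶠ c x)

  unchanged : ∀ {x} → ¬ Changed x → c′ x ≡ c x
  unchanged = decidable-stable (_ ≟ᶠ _)

  changed⇒reach : ∀ {x} → Changed x → ¬ ¬ Reach c i j v x
  changed⇒reach {x} ch ¬r = ch (proj₂ (change x) ¬r)

  changed⇒InIJ : ∀ {x} → Changed x → InIJ c i j x
  changed⇒InIJ {x} ch = decidable-stable (InIJ? c i j x) (λ ∉ → changed⇒reach ch (∉ ∘ Reach⇒InIJ))

  changed⇒swapped : ∀ {x} → Changed x → c′ x ≡ swap i j (c x)
  changed⇒swapped {x} ch = decidable-stable (_ ≟ᶠ _) (λ ≢ → changed⇒reach ch (≢ ∘ proj₁ (change x)))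

  changed⇒i≢j : ∀ {x} → Changed x → i ≢ j
  changed⇒i≢j {x} ch refl = ch (trans (changed⇒swapped ch) (swap-self i (c x)))

  changed-spreads : ∀ {x y} → Changed x → Adj x y → InIJ c i j y → Changed y
  changed-spreads {y = y} ch x~y y∈ c′y≡cy = changed⇒reach ch λ r →
    swap-moves (changed⇒i≢j ch) y∈ (trans (sym (proj₁ (change y) (ext r x~y y∈))) c′y≡cy)

  InIJ-preserved : ∀ x → InIJ c′ i j x ⇔ InIJ c i j x
  InIJ-preserved x with changed? x
  ... | yes ch = mk⇔ (λ _ → changed⇒InIJ ch)
                     (λ _ → ∈ij-resp (sym (changed⇒swapped ch)) (swap-∈ij (changed⇒InIJ ch)))
  ... | no ¬ch = mk⇔ (∈ij-resp (unchanged ¬ch)) (∈ij-resp (sym (unchanged ¬ch)))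

  NotSplit : V n → V n → Set
  NotSplit x y = InIJ c i j x → InIJ c i j y → Changed x ⇔ Changed y

  notSplit-sym : ∀ {x y} → NotSplit x y → NotSplit y x
  notSplit-sym ns y∈ x∈ = ⇔-sym (ns x∈ y∈)

  notSplit-trans : ∀ {x y z} → InIJ c i j y → NotSplit x y → NotSplit y z → NotSplit x z
  notSplit-trans y∈ nxy nyz x∈ z∈ = nyz y∈ z∈ ⇔-∘ nxy x∈ y∈

  adjacent-notSplit : ∀ {x y} → Adj x y → NotSplit x y
  adjacent-notSplit x~y x∈ y∈ = mk⇔ (λ ch → changed-spreads ch x~y y∈)
                                    (λ ch → changed-spreads ch (adj-sym x~y) x∈)

  linked-notSplit : ∀ {s t} → Linked c′ s t → NotSplit s t
  linked-notSplit {s} {t} (x , y , s~x , x~y , y~t , c′x≡c′t , c′y≡c′s) s∈ t∈ =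
    notSplit-trans x∈ (adjacent-notSplit s~x)
      (notSplit-trans y∈ (adjacent-notSplit x~y) (adjacent-notSplit y~t)) s∈ t∈
    where
    x∈ : InIJ c i j x
    x∈ = to (InIJ-preserved x) (∈ij-resp (sym c′x≡c′t) (from (InIJ-preserved t) t∈))
    y∈ : InIJ c i j y
    y∈ = to (InIJ-preserved y) (∈ij-resp (sym c′y≡c′s) (from (InIJ-preserved s) s∈))

  split-colours-differ : ∀ {x y} → NotSplit x y → Changed x → ¬ Changed y →
                         c′ x ≢ c′ y × c x ≢ c y
  split-colours-differ {x} {y} ns ch ¬ch =
      (λ eq → y∉ (to (InIJ-preserved y) (∈ij-resp eq (from (InIJ-preserved x) x∈))))
    , (λ eq → y∉ (∈ij-resp eq x∈))
    where
    x∈ : InIJ c i j x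
    x∈ = changed⇒InIJ ch
    y∉ : ¬ InIJ c i j y
    y∉ y∈ = ¬ch (to (ns x∈ y∈) ch)

  colour-equality-preserved : ∀ {x y} → NotSplit x y → c′ x ≡ c′ y ⇔ c x ≡ c y
  colour-equality-preserved {x} {y} ns with changed? x | changed? y
  ... | yes chx | yes chy =
    mk⇔ (λ eq → swap-injective i j (trans (sym (changed⇒swapped chx)) (trans eq (changed⇒swapped chy))))
        (λ eq → trans (changed⇒swapped chx) (trans (cong (swap i j) eq) (sym (changed⇒swapped chy))))
  ... | no ¬chx | no ¬chy =
    mk⇔ (λ eq → trans (sym (unchanged ¬chx)) (trans eq (unchanged ¬chy)))
        (λ eq → trans (unchanged ¬chx) (trans eq (sym (unchanged ¬chy))))
  ... | yes chx | no ¬chy =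
    let (c′≢ , c≢) = split-colours-differ ns chx ¬chy in mk⇔ (⊥-elim ∘ c′≢) (⊥-elim ∘ c≢)
  ... | no ¬chx | yes chy =
    let (c′≢ , c≢) = split-colours-differ (notSplit-sym ns) chy ¬chx in
    mk⇔ (⊥-elim ∘ c′≢ ∘ sym) (⊥-elim ∘ c≢ ∘ sym)

  pole-colours-preserved : Linked c′ pa pb → c′ pa ≡ c′ pb ⇔ c pa ≡ c pb
  pole-colours-preserved = colour-equality-preserved ∘ linked-notSplit

  -- If a ∈ A(i,j), every u k is tied to b through a; otherwise no w k can be split from a.
  uLikeB-or-wLikeA-preserved : Linked c′ pa pb → (∀ k → uLikeB c′ k ≡ uLikeB c k) ⊎ (∀ k → wLikeA c′ k ≡ wLikeA c k)
  uLikeB-or-wLikeA-preserved link with InIJ? c i j pa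
  ... | yes a∈ = inj₁ λ k → δ-cong-⇔ (colour-equality-preserved
                   (notSplit-trans a∈ (adjacent-notSplit (inj₂ (aU k))) (linked-notSplit link)))
  ... | no a∉  = inj₂ λ k → δ-cong-⇔ (colour-equality-preserved λ _ a∈ → ⊥-elim (a∉ a∈))

kempe-step : ∀ {n} (X Y : C4 n) → KempeChange X Y → 0 < d Y → d X ≡ d Y
kempe-step X@(c , proper) Y@(c′ , proper′) (i , j , v , _ , change) dY>0 =
  d-determined-by-uLikeB X Y P≢Q P′≢Q′ sum-uLikeB-preserved
  where
  open Kempe c c′ i j v change

  link : Linked c′ pa pb
  link = d>0⇒linked Y dY>0

  P′≢Q′ : c′ pa ≢ c′ pb
  P′≢Q′ = linked⇒distinct proper′ link

  P≢Q : c pa ≢ c pb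
  P≢Q = P′≢Q′ ∘ from (pole-colours-preserved link)

  sum-uLikeB-preserved : sum (uLikeB c) ≡ sum (uLikeB c′)
  sum-uLikeB-preserved with uLikeB-or-wLikeA-preserved link
  ... | inj₁ uLikeB-eq = sym (sum-cong-≗ uLikeB-eq)
  ... | inj₂ wLikeA-eq = begin
    sum (uLikeB c)  ≡⟨ Counting.sum-uLikeB≡sum-wLikeA c proper P≢Q ⟩
    sum (wLikeA c)  ≡⟨ sum-cong-≗ wLikeA-eq ⟨
    sum (wLikeA c′) ≡⟨ Counting.sum-uLikeB≡sum-wLikeA c′ proper′ P′≢Q′ ⟨
    sum (uLikeB c′) ∎
    where open ≡-Reasoning

d-invariant : ∀ {n} (A B : C4 n) → 0 < d A → B ∼ A → d B ≡ d A
d-invariant A B dA>0 ε = refl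
d-invariant A B dA>0 (_◅_ {j = C} step steps) =
  let dC≡dA = d-invariant A C dA>0 steps in
  trans (kempe-step B C step (subst (0 <_) (sym dC≡dA) dA>0)) dC≡dA

lemma1p4 : (n : ℕ) → 5 ≤ n → (A B : C4 n) → 1 < d A → B ∼ A → d B ≡ d A
lemma1p4 n _ A B dA>1 = d-invariant A B (<-trans z<s dA>1)
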